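{- Let $k\in \mathbb{Z}$ and $n,m,d\in\mathbb{Z}^+$ with $n\geq 2$ and $k\not\equiv 0\pmod n$, let $T_{m,d}$ be the rooted complete $m$-ary tree of height $d$, and write $\delta = \lfloor d/2 \rfloor$. If $d$ is even, then $\chi_{(n,k)}(T_{m,d})$ exists if and only if \[ n\mid \left( k \, \frac{m^{\delta +1}+ (-1)^{\delta}}{m+1} \right), \] and in that case $\chi_{(n,k)}(T_{m,d}) \leq d+1$. If $d$ is odd, then $\chi_{(n,k)}(T_{m,d})$ always exists; if $n\mid \left( k \, \frac{m^{\delta +1}+ (-1)^{\delta}}{m+1} \right)$ then $\chi_{(n,k)}(T_{m,d}) \leq d + 1$, and otherwise $\chi_{(n,k)}(T_{m,d}) \leq d+\delta+2$.
   Context: $T_{m,d}$ is the rooted tree in which every vertex at distance less than $d$ from the root has exactly $m$ children and all leaves are at distance $d$ from the root. For a graph $G=(V,E)$, a $\mathbb{Z}$-labeling is a map $\ell:V\to\mathbb{Z}$; its order is the size of its range; it is proper if adjacent vertices get different labels. $N(v)$ is the open neighborhood of $v$. An open coloring with remainder $k \bmod n$ is a labeling with $\sum_{w\in N(v)}\ell(w)\equiv k \pmod n$ for all $v\in V$. If no proper such coloring exists, $\chi_{(n,k)}(G)$ does not exist; otherwise it is the minimum order of a proper open coloring with remainder $k\bmod n$. -}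

module Defs where

open import Data.Nat as ℕ using (ℕ; zero; suc; _≤_; _<_; _≤?_; s≤s)
open import Data.Nat.Properties using (≤-trans; n≤1+n)
open import Data.Integer as ℤ using (ℤ; +_; -_; _+_; _-_; _*_; _^_)
open import Data.Integer.Divisibility using (_∣_)
open import Data.Fin using (Fin)
open import Data.List using (List; []; _∷_; length; map; foldr; allFin)
open import Data.List.Membership.Propositional using (_∈_)
open import Data.List.Relation.Unary.Unique.Propositional using (Unique)
open import Data.Product using (Σ; ∃; _×_; _,_; proj₁)
open import Data.Sum using (_⊎_)
open import Relation.Nullary using (¬_; yes; no)
open import Relation.Binary.PropositionalEquality using (_≡_; _≢_)

-- Vertices of T_{m,d}: a vertex is the path from the root, stored
-- as a list of child indices (most recent step first), of length ≤ d.
Vertex : ℕ → ℕ → Set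
Vertex m d = Σ (List (Fin m)) λ p → length p ≤ d

Child : ∀ {m d} → Vertex m d → Vertex m d → Set
Child {m} u v = ∃ λ (c : Fin m) → proj₁ v ≡ c ∷ proj₁ u

Adj : ∀ {m d} → Vertex m d → Vertex m d → Set
Adj u v = Child u v ⊎ Child v u

sumℤ : List ℤ → ℤ
sumℤ = foldr _+_ (+ 0)

Labeling : ℕ → ℕ → Set
Labeling m d = Vertex m d → ℤ

parentSum : ∀ {m d} → Labeling m d → Vertex m d → ℤ
parentSum ℓ ([] , _) = + 0
parentSum ℓ (c ∷ q , le) = ℓ (q , ≤-trans (n≤1+n _) le)

childSum : ∀ {m d} → Labeling m d → Vertex m d → ℤ
childSum {m} {d} ℓ (p , _) with suc (length p) ≤? d
... | yes lt = sumℤ (map (λ c → ℓ (c ∷ p , lt)) (allFin m))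
... | no _ = + 0

nbrSum : ∀ {m d} → Labeling m d → Vertex m d → ℤ
nbrSum ℓ v = parentSum ℓ v + childSum ℓ v

Proper : ∀ {m d} → Labeling m d → Set
Proper {m} {d} ℓ = ∀ (u v : Vertex m d) → Adj u v → ℓ u ≢ ℓ v

OpenColoring : ∀ {m d} → ℕ → ℤ → Labeling m d → Set
OpenColoring {m} {d} n k ℓ = ∀ (v : Vertex m d) → (+ n) ∣ (nbrSum ℓ v - k)

HasOrder : ∀ {m d} → Labeling m d → ℕ → Set
HasOrder {m} {d} ℓ r = Σ (List ℤ) λ L →
  Unique L × length L ≡ r × (∀ v → ℓ v ∈ L) × (∀ x → x ∈ L → ∃ λ v → ℓ v ≡ x)

ChiExists : ℕ → ℤ → ℕ → ℕ → Set
ChiExists n k m d = Σ (Labeling m d) λ ℓ → Proper ℓ × OpenColoring n k ℓ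

-- χ_{(n,k)}(T_{m,d}) exists and is ≤ b  (minimum order ≤ b iff some
-- proper open coloring has order ≤ b)
ChiLE : ℕ → ℤ → ℕ → ℕ → ℕ → Set
ChiLE n k m d b = Σ (Labeling m d) λ ℓ → Proper ℓ × OpenColoring n k ℓ ×
  (∃ λ r → HasOrder ℓ r × r ≤ b)

-- the quantity k (m^{δ+1} + (-1)^δ)/(m+1), integer division (exact)
cond : ℤ → ℕ → ℕ → ℤ
cond k m δ = k * ((((+ m) ^ suc δ) + ((- + 1) ^ δ)) ℤ./ (+ suc m))

{-# OPTIONS --safe #-}
-- Work modulo n and sort the vertices by their height h (distance to the leaves).  Put
-- s_j = Σ_{i ≤ j} (-m)^i.  Going up from the leaves, the open condition at the vertices
-- below forces every label at height 2j+1 to be ≡ k s_j, and the labels of the children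
-- of a vertex at height 2j to sum to ≡ k - k s_j.  At a root of even height d = 2δ the
-- open condition therefore says k s_δ ≡ 0, and cond k m δ = ± k s_δ.
--
-- Conversely, label each vertex at height 2j+1 by n + (k s_j mod n) ∈ [n, 2n), and each
-- vertex at even height by k mod n or 0, giving k mod n to the first child of every
-- odd-height vertex whose parent got 0, and 0 to all other vertices.  Every open
-- condition then holds (at an even root exactly when k s_δ ≡ 0); the labelling is proper
-- since even and odd heights use labels in [0, n) and [n, 2n) respectively; and it uses
-- at most 2 + ⌈d/2⌉ ≤ d + 1 labels once d ≥ 2, while for d = 1 divisibility would say n ∣ k.
module Submission where

open import Defs
open import Data.Bool using (Bool; true; false; not; if_then_else_)
open import Data.Fin using (Fin; zero; suc)
open import Data.Integer as ℤ using (ℤ; +_; -_; _-_; _*_; _^_; ∣_∣; 0ℤ; 1ℤ; -1ℤ)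
open import Data.Integer.Properties as ℤ using (-1*i≡-i; ∣-i∣≡∣i∣; abs-*)
open import Data.Integer.DivMod using (div-pos-is-/ℕ; a≡a%ℕn+[a/ℕn]*n; n%ℕd<d)
open import Data.Integer.Divisibility using (_∣_)
import Data.Integer.Divisibility.Signed as Signed
open import Data.Integer.Tactic.RingSolver using (solve-∀)
open import Data.List using (List; []; _∷_; length; map; concat; tabulate; allFin; upTo; drop; filter; deduplicate)
open import Data.List.Properties using (map-tabulate; length-map; length-upTo; length-filter; length-deduplicate)
open import Data.List.Membership.Propositional using (_∈_)
open import Data.List.Membership.Propositional.Properties
  using (∈-map⁺; ∈-map⁻; ∈-concat⁺′; ∈-allFin; ∈-upTo⁺; ∈-filter⁺; ∈-filter⁻; ∈-deduplicate⁺; ∈-deduplicate⁻)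
open import Data.List.Membership.DecPropositional ℤ._≟_ using (_∈?_)
open import Data.List.Relation.Unary.Any using (here; there)
open import Data.List.Relation.Unary.Unique.DecPropositional.Properties ℤ._≟_ using (deduplicate-!)
open import Data.Nat as ℕ using (ℕ; zero; suc; _≤_; _<_; _∸_; _≤?_; z≤n; s≤s; ⌈_/2⌉; NonZero)
import Data.Nat.DivMod as ℕ
open import Data.Nat.Divisibility using () renaming (_∣_ to _∣ℕ_)
import Data.Nat.Properties as ℕ
import Data.Nat.Tactic.RingSolver as ℕ-Solver
open import Data.Product using (∃; _×_; _,_; proj₁; proj₂)
open import Data.Sum using (inj₁; inj₂)
open import Data.Unit using (⊤; tt)
open import Function using (_∘_)
open import Function.Bundles using (_⇔_; mk⇔; Equivalence)
open import Level using (0ℓ)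
open import Relation.Binary.Bundles using (Setoid)
open import Relation.Binary.PropositionalEquality
open import Relation.Nullary using (¬_; yes; no; contradiction)

-- Integer addition is opened only inside the modules that need it, because theorem6p12
-- is stated with the addition of ℕ.
module AlternatingSum where
  open import Data.Integer using (_+_)

  -- altGeomSum m j = Σ_{i ≤ j} (-m)^i = (1 - (-m)^{j+1}) / (1 + m)
  altGeomSum : ℕ → ℕ → ℤ
  altGeomSum m zero    = 1ℤ
  altGeomSum m (suc j) = 1ℤ - + m * altGeomSum m j

  ∣[-1]^n∣≡1 : ∀ n → ∣ -1ℤ ^ n ∣ ≡ 1
  ∣[-1]^n∣≡1 zero    = refl
  ∣[-1]^n∣≡1 (suc n) = trans (cong ∣_∣ (-1*i≡-i (-1ℤ ^ n))) (trans (∣-i∣≡∣i∣ (-1ℤ ^ n)) (∣[-1]^n∣≡1 n))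

  i*n/n≡i : ∀ i n .{{_ : NonZero n}} → (i * + n) ℤ./ + n ≡ i
  i*n/n≡i i n@(suc _) = trans (div-pos-is-/ℕ (i * + n) n) (exact i)
    where
    exact : ∀ i → (i * + n) ℤ./ℕ n ≡ i
    exact (+ zero)    = refl
    exact (+ suc a)   = cong +_ (ℕ.m*n/n≡m (suc a) n)
    -- On a negative dividend ℤ./ℕ branches on the remainder, which is 0 here.
    exact ℤ.-[1+ a ] with ∣ ℤ.-[1+ a ] * + n ∣ ℕ.% n | ℕ.m*n%n≡0 (suc a) n
    ... | zero | _ = cong (λ q → - (+ q)) (ℕ.m*n/n≡m (suc a) n)

  cond-numerator : ∀ m δ → (+ m) ^ suc δ + -1ℤ ^ δ ≡ -1ℤ ^ δ * altGeomSum m δ * + suc m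
  cond-numerator m zero    = base (+ m)
    where
    base : ∀ m → m * 1ℤ + 1ℤ ≡ 1ℤ * 1ℤ * (1ℤ + m)
    base = solve-∀
  cond-numerator m (suc δ) = begin
    + m * P + -1ℤ * σ                           ≡⟨ regroup (+ m) P σ ⟩
    + m * (P + σ) - σ * (1ℤ + + m)              ≡⟨ cong (λ x → + m * x - σ * (1ℤ + + m)) (cond-numerator m δ) ⟩
    + m * (σ * s * (1ℤ + + m)) - σ * (1ℤ + + m) ≡⟨ factor (+ m) σ s ⟩
    -1ℤ * σ * (1ℤ - + m * s) * (1ℤ + + m)       ∎
    where
    open ≡-Reasoning
    P σ s : ℤ
    P = (+ m) ^ suc δ
    σ = -1ℤ ^ δ
    s = altGeomSum m δ
    regroup : ∀ m P σ → m * P + -1ℤ * σ ≡ m * (P + σ) - σ * (1ℤ + m)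
    regroup = solve-∀
    factor : ∀ m σ s → m * (σ * s * (1ℤ + m)) - σ * (1ℤ + m) ≡ -1ℤ * σ * (1ℤ - m * s) * (1ℤ + m)
    factor = solve-∀

  ∣cond∣≡∣k*altGeomSum∣ : ∀ k m δ → ∣ cond k m δ ∣ ≡ ∣ k * altGeomSum m δ ∣
  ∣cond∣≡∣k*altGeomSum∣ k m δ = begin
    ∣ k * (((+ m) ^ suc δ + σ) ℤ./ + suc m) ∣ ≡⟨ cong (λ x → ∣ k * (x ℤ./ + suc m) ∣) (cond-numerator m δ) ⟩
    ∣ k * ((σ * s * + suc m) ℤ./ + suc m) ∣   ≡⟨ cong (λ x → ∣ k * x ∣) (i*n/n≡i (σ * s) (suc m)) ⟩
    ∣ k * (σ * s) ∣                           ≡⟨ abs-* k (σ * s) ⟩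
    ∣ k ∣ ℕ.* ∣ σ * s ∣                       ≡⟨ cong (∣ k ∣ ℕ.*_) (abs-* σ s) ⟩
    ∣ k ∣ ℕ.* (∣ σ ∣ ℕ.* ∣ s ∣)               ≡⟨ cong (λ x → ∣ k ∣ ℕ.* (x ℕ.* ∣ s ∣)) (∣[-1]^n∣≡1 δ) ⟩
    ∣ k ∣ ℕ.* (1 ℕ.* ∣ s ∣)                   ≡⟨ cong (∣ k ∣ ℕ.*_) (ℕ.*-identityˡ ∣ s ∣) ⟩
    ∣ k ∣ ℕ.* ∣ s ∣                           ≡⟨ abs-* k s ⟨
    ∣ k * s ∣                                 ∎
    where
    open ≡-Reasoning
    σ s : ℤ
    σ = -1ℤ ^ δ
    s = altGeomSum m δ

  ∣cond⇔∣k*altGeomSum : ∀ n k m δ → (+ n ∣ cond k m δ) ⇔ (+ n ∣ k * altGeomSum m δ)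
  ∣cond⇔∣k*altGeomSum n k m δ = mk⇔ (subst (n ∣ℕ_) eq) (subst (n ∣ℕ_) (sym eq))
    where
    eq : ∣ cond k m δ ∣ ≡ ∣ k * altGeomSum m δ ∣
    eq = ∣cond∣≡∣k*altGeomSum∣ k m δ

  ∣cond[0]⇒∣k : ∀ n k m → + n ∣ cond k m 0 → + n ∣ k
  ∣cond[0]⇒∣k n k m = subst (+ n ∣_) (ℤ.*-identityʳ k) ∘ Equivalence.to (∣cond⇔∣k*altGeomSum n k m 0)

module Congruence where
  open import Data.Integer using (_+_)

  -- A record rather than a synonym, so that x and y can be inferred from a proof.
  infix 4 _≡_mod_
  record _≡_mod_ (x y : ℤ) (n : ℕ) : Set where
    constructor modulo
    field n∣x-y : + n Signed.∣ x - y
  open _≡_mod_ public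

  module _ {n : ℕ} where

    ≡⇒≡-mod : ∀ {x y} → x ≡ y → x ≡ y mod n
    ≡⇒≡-mod {x} refl = modulo (Signed.divides 0ℤ (trans (ℤ.+-inverseʳ x) (sym (ℤ.*-zeroˡ (+ n)))))

    ≡-mod-sym : ∀ {x y} → x ≡ y mod n → y ≡ x mod n
    ≡-mod-sym {x} {y} (modulo n∣x-y) = modulo (subst (+ n Signed.∣_) (negate x y) (Signed.∣m⇒∣-m n∣x-y))
      where
      negate : ∀ x y → - (x - y) ≡ y - x
      negate = solve-∀

    ≡-mod-trans : ∀ {x y z} → x ≡ y mod n → y ≡ z mod n → x ≡ z mod n
    ≡-mod-trans {x} {y} {z} (modulo n∣x-y) (modulo n∣y-z) =
      modulo (subst (+ n Signed.∣_) (telescope x y z) (Signed.∣m∣n⇒∣m+n n∣x-y n∣y-z))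
      where
      telescope : ∀ x y z → (x - y) + (y - z) ≡ x - z
      telescope = solve-∀

    +-cong : ∀ {a b c d} → a ≡ b mod n → c ≡ d mod n → a + c ≡ b + d mod n
    +-cong {a} {b} {c} {d} (modulo n∣a-b) (modulo n∣c-d) =
      modulo (subst (+ n Signed.∣_) (regroup a b c d) (Signed.∣m∣n⇒∣m+n n∣a-b n∣c-d))
      where
      regroup : ∀ a b c d → (a - b) + (c - d) ≡ (a + c) - (b + d)
      regroup = solve-∀

    -‿cong : ∀ {a b} → a ≡ b mod n → - a ≡ - b mod n
    -‿cong {a} {b} (modulo n∣a-b) = modulo (subst (+ n Signed.∣_) (negate a b) (Signed.∣m⇒∣-m n∣a-b))
      where
      negate : ∀ a b → - (a - b) ≡ - a - - b
      negate = solve-∀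

    n+x≡x : ∀ x → + n + x ≡ x mod n
    n+x≡x x = modulo (Signed.divides 1ℤ (cancel (+ n) x))
      where
      cancel : ∀ n x → n + x - x ≡ 1ℤ * n
      cancel = solve-∀

    x%n≡x : ∀ x .{{_ : NonZero n}} → + (x ℤ.%ℕ n) ≡ x mod n
    x%n≡x x = modulo (Signed.divides (- q) (trans (cong (λ y → r - y) (a≡a%ℕn+[a/ℕn]*n x n)) (cancel r q (+ n))))
      where
      r q : ℤ
      r = + (x ℤ.%ℕ n)
      q = x ℤ./ℕ n
      cancel : ∀ r q n → r - (r + q * n) ≡ - q * n
      cancel = solve-∀

    ∣⇒≡0 : ∀ {x} → + n ∣ x → x ≡ 0ℤ mod n
    ∣⇒≡0 {x} n∣x = modulo (subst (+ n Signed.∣_) (sym (ℤ.+-identityʳ x)) (Signed.∣ᵤ⇒∣ n∣x))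

    ∣x-y⇒≡-mod : ∀ {x y} → + n ∣ x - y → x ≡ y mod n
    ∣x-y⇒≡-mod = modulo ∘ Signed.∣ᵤ⇒∣

    ≡-mod⇒∣x-y : ∀ {x y} → x ≡ y mod n → + n ∣ x - y
    ≡-mod⇒∣x-y = Signed.∣⇒∣ᵤ ∘ n∣x-y

    ≡0⇒∣ : ∀ {x} → x ≡ 0ℤ mod n → + n ∣ x
    ≡0⇒∣ {x} (modulo n∣x-0) = Signed.∣⇒∣ᵤ (subst (+ n Signed.∣_) (ℤ.+-identityʳ x) n∣x-0)

  ≡-mod-setoid : ℕ → Setoid 0ℓ 0ℓ
  ≡-mod-setoid n = record
    { Carrier       = ℤ
    ; _≈_           = _≡_mod n
    ; isEquivalence = record { refl = ≡⇒≡-mod refl ; sym = ≡-mod-sym ; trans = ≡-mod-trans }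
    }

  module _ {n : ℕ} where
    open import Relation.Binary.Reasoning.Setoid (≡-mod-setoid n)

    sumℤ-tabulate-≡ : ∀ {m} (f : Fin m → ℤ) {x} → (∀ i → f i ≡ x mod n) →
                      sumℤ (tabulate f) ≡ + m * x mod n
    sumℤ-tabulate-≡ {zero}  f     f≡x = ≡⇒≡-mod refl
    sumℤ-tabulate-≡ {suc m} f {x} f≡x = begin
      f zero + sumℤ (tabulate (f ∘ suc)) ≈⟨ +-cong (f≡x zero) (sumℤ-tabulate-≡ (f ∘ suc) (f≡x ∘ suc)) ⟩
      x + + m * x                        ≡⟨ distrib x (+ m) ⟩
      + suc m * x                        ∎
      where
      distrib : ∀ x m → x + m * x ≡ (1ℤ + m) * x
      distrib = solve-∀

  sumℤ-tabulate-zero : ∀ m → sumℤ (tabulate {n = m} (λ _ → 0ℤ)) ≡ 0ℤ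
  sumℤ-tabulate-zero zero    = refl
  sumℤ-tabulate-zero (suc m) = trans (ℤ.+-identityˡ _) (sumℤ-tabulate-zero m)

open AlternatingSum
open Congruence

module _ {m d : ℕ} where

  path : Vertex m d → List (Fin m)
  path = proj₁

  depth : Vertex m d → ℕ
  depth v = length (path v)

  height : Vertex m d → ℕ
  height v = d ∸ depth v

  root : Vertex m d
  root = [] , z≤n

  child : (v : Vertex m d) → suc (depth v) ≤ d → Fin m → Vertex m d
  child (p , _) lt c = c ∷ p , lt

  height-child : ∀ v lt c → height v ≡ suc (height (child v lt c))
  height-child v lt c = ℕ.+-∸-assoc 1 lt

  height≡suc⇒has-children : ∀ {h} v → height v ≡ suc h → suc (depth v) ≤ d
  height≡suc⇒has-children v eq = ℕ.m∸n≢0⇒n<m (λ eq0 → ℕ.0≢1+n (trans (sym eq0) eq))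

  parentSum-child : ∀ ℓ v lt c → parentSum ℓ (child v lt c) ≡ ℓ v
  parentSum-child ℓ (p , le) lt c = cong (λ le′ → ℓ (p , le′)) (ℕ.≤-irrelevant _ le)

  childSum-inner : ∀ ℓ v lt → childSum ℓ v ≡ sumℤ (tabulate (ℓ ∘ child v lt))
  childSum-inner ℓ (p , le) lt with suc (length p) ≤? d
  ... | yes lt′ = cong sumℤ (trans (cong (λ lt″ → map (λ c → ℓ (c ∷ p , lt″)) (allFin m)) (ℕ.≤-irrelevant lt′ lt))
                                   (map-tabulate (λ c → c) (ℓ ∘ child (p , le) lt)))
  ... | no ¬lt  = contradiction lt ¬lt

  childSum-leaf : ∀ ℓ v → height v ≡ 0 → childSum ℓ v ≡ + 0
  childSum-leaf ℓ (p , le) height≡0 with suc (length p) ≤? d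
  ... | yes lt = contradiction (ℕ.m∸n≡0⇒m≤n height≡0) (ℕ.<⇒≱ lt)
  ... | no _   = refl

data Layer : Set where
  even odd : ℕ → Layer

above : Layer → Layer
above (even j) = odd j
above (odd j)  = even (suc j)

layer : ℕ → Layer
layer zero    = even 0
layer (suc h) = above (layer h)

layerHeight : Layer → ℕ
layerHeight (even j) = j ℕ.+ j
layerHeight (odd j)  = suc (j ℕ.+ j)

layerHeight-above : ∀ L → layerHeight (above L) ≡ suc (layerHeight L)
layerHeight-above (even j) = refl
layerHeight-above (odd j)  = cong suc (ℕ.+-suc j j)

layerHeight-layer : ∀ h → layerHeight (layer h) ≡ h
layerHeight-layer zero    = refl
layerHeight-layer (suc h) = trans (layerHeight-above (layer h)) (cong suc (layerHeight-layer h))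

layer-double : ∀ j → layer (j ℕ.+ j) ≡ even j
layer-double zero    = refl
layer-double (suc j) = trans (cong (above ∘ layer) (ℕ.+-suc j j)) (cong (above ∘ above) (layer-double j))

RootCondition : ℕ → ℤ → ℕ → Layer → Set
RootCondition n k m (even δ) = + n ∣ k * altGeomSum m δ
RootCondition n k m (odd _)  = ⊤

module Necessity {n m₀ d : ℕ} (k : ℤ) (ℓ : Labeling (suc m₀) d)
                 (ℓ-open : ∀ v → nbrSum ℓ v ≡ k mod n) where
  open import Data.Integer using (_+_)
  open import Relation.Binary.Reasoning.Setoid (≡-mod-setoid n)

  m : ℕ
  m = suc m₀

  x-[x-y]≡y : ∀ x y → x - (x - y) ≡ y
  x-[x-y]≡y = solve-∀

  mutual
    childSum-at-even-height : ∀ j v → height v ≡ j ℕ.+ j → childSum ℓ v ≡ k - k * altGeomSum m j mod n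
    childSum-at-even-height zero v height≡0 = ≡⇒≡-mod (trans (childSum-leaf ℓ v height≡0) (sym (k-k*1≡0 k)))
      where
      k-k*1≡0 : ∀ k → k - k * 1ℤ ≡ + 0
      k-k*1≡0 = solve-∀
    childSum-at-even-height (suc j) v height≡ = begin
      childSum ℓ v                     ≡⟨ childSum-inner ℓ v lt ⟩
      sumℤ (tabulate (ℓ ∘ child v lt)) ≈⟨ sumℤ-tabulate-≡ _ (λ c → label-at-odd-height j (child v lt c) (height-below c)) ⟩
      + m * (k * altGeomSum m j)       ≡⟨ expand k (+ m) (altGeomSum m j) ⟩
      k - k * altGeomSum m (suc j)     ∎
      where
      height≡′ : height v ≡ suc (suc (j ℕ.+ j))
      height≡′ = trans height≡ (cong suc (ℕ.+-suc j j))
      lt : suc (depth v) ≤ d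
      lt = height≡suc⇒has-children v height≡′
      height-below : ∀ c → height (child v lt c) ≡ suc (j ℕ.+ j)
      height-below c = ℕ.suc-injective (trans (sym (height-child v lt c)) height≡′)
      expand : ∀ k m s → m * (k * s) ≡ k - k * (1ℤ - m * s)
      expand = solve-∀

    label-at-odd-height : ∀ j v → height v ≡ suc (j ℕ.+ j) → ℓ v ≡ k * altGeomSum m j mod n
    label-at-odd-height j v height≡ = begin
      ℓ v                               ≡⟨ cancel (ℓ v) (childSum ℓ w) ⟩
      ℓ v + childSum ℓ w - childSum ℓ w ≡⟨ cong (λ x → x + childSum ℓ w - childSum ℓ w) (parentSum-child ℓ v lt zero) ⟨
      nbrSum ℓ w - childSum ℓ w         ≈⟨ +-cong (ℓ-open w) (-‿cong (childSum-at-even-height j w height-below)) ⟩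
      k - (k - k * altGeomSum m j)      ≡⟨ x-[x-y]≡y k (k * altGeomSum m j) ⟩
      k * altGeomSum m j                ∎
      where
      lt : suc (depth v) ≤ d
      lt = height≡suc⇒has-children v height≡
      w : Vertex m d
      w = child v lt zero
      height-below : height w ≡ j ℕ.+ j
      height-below = ℕ.suc-injective (trans (sym (height-child v lt zero)) height≡)
      cancel : ∀ x y → x ≡ x + y - y
      cancel = solve-∀

  k*altGeomSum≡0 : ∀ δ → d ≡ δ ℕ.+ δ → k * altGeomSum m δ ≡ 0ℤ mod n
  k*altGeomSum≡0 δ d≡ = begin
    k * altGeomSum m δ                      ≡⟨ x-[x-y]≡y k (k * altGeomSum m δ) ⟨
    k - (k - k * altGeomSum m δ)            ≈⟨ +-cong (ℓ-open root) (-‿cong (childSum-at-even-height δ root d≡)) ⟨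
    + 0 + childSum ℓ root - childSum ℓ root ≡⟨ cancel (childSum ℓ root) ⟩
    0ℤ                                      ∎
    where
    cancel : ∀ x → + 0 + x - x ≡ 0ℤ
    cancel = solve-∀

chiExists⇒rootCondition : ∀ {n k m₀ d} → ChiExists n k (suc m₀) d → RootCondition n k (suc m₀) (layer d)
chiExists⇒rootCondition {n} {k} {m₀} {d} (ℓ , _ , ℓ-open) with layer d in d-layer
... | even δ = ≡0⇒∣ (Necessity.k*altGeomSum≡0 k ℓ (∣x-y⇒≡-mod ∘ ℓ-open) δ d≡δ+δ)
  where
  d≡δ+δ : d ≡ δ ℕ.+ δ
  d≡δ+δ = trans (sym (layerHeight-layer d)) (cong layerHeight d-layer)
... | odd _  = tt

vertices : ∀ m d → List (Vertex m d)
vertices m zero    = root ∷ []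
vertices m (suc d) = root ∷ concat (map (λ c → map (extend c) (vertices m d)) (allFin m))
  where
  extend : Fin m → Vertex m d → Vertex m (suc d)
  extend c (p , le) = c ∷ p , s≤s le

∈-vertices : ∀ {m d} (v : Vertex m d) → v ∈ vertices m d
∈-vertices {d = zero}  ([] , z≤n)         = here refl
∈-vertices {d = suc d} ([] , z≤n)         = here refl
∈-vertices {d = suc d} (c ∷ p , s≤s le) =
  there (∈-concat⁺′ (∈-map⁺ _ (∈-vertices (p , le))) (∈-map⁺ _ (∈-allFin c)))

order≤length : ∀ {m d} (ℓ : Labeling m d) (C : List ℤ) → (∀ v → ℓ v ∈ C) →
               ∃ λ r → HasOrder ℓ r × r ≤ length C
order≤length {m} {d} ℓ C ℓ∈C = length range , (range , deduplicate-! values , refl , covers , attained) , bound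
  where
  image values range : List ℤ
  image  = map ℓ (vertices m d)
  values = filter (_∈? image) C
  range  = deduplicate ℤ._≟_ values
  covers : ∀ v → ℓ v ∈ range
  covers v = ∈-deduplicate⁺ ℤ._≟_ (∈-filter⁺ (_∈? image) (ℓ∈C v) (∈-map⁺ ℓ (∈-vertices v)))
  attained : ∀ x → x ∈ range → ∃ λ v → ℓ v ≡ x
  attained x x∈range
    with ∈-map⁻ ℓ (proj₂ (∈-filter⁻ (_∈? image) {xs = C} (∈-deduplicate⁻ ℤ._≟_ values x∈range)))
  ... | v , _ , x≡ℓv = v , sym x≡ℓv
  bound : length range ≤ length C
  bound = ℕ.≤-trans (length-deduplicate ℤ._≟_ values) (length-filter (_∈? image) C)

1+[j+j]≤n⇒j<⌈n/2⌉ : ∀ j {n} → suc (j ℕ.+ j) ≤ n → j < ⌈ n /2⌉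
1+[j+j]≤n⇒j<⌈n/2⌉ j {n} le = subst (_≤ ⌈ n /2⌉) (cong suc (sym (ℕ.n≡⌊n+n/2⌋ j))) (ℕ.⌈n/2⌉-mono le)

module Construction (n : ℕ) .{{_ : NonZero n}} (k : ℤ) (m₀ d : ℕ) where
  open import Data.Integer using (_+_)
  open import Relation.Binary.Reasoning.Setoid (≡-mod-setoid n)

  m : ℕ
  m = suc m₀

  K : ℕ
  K = k ℤ.%ℕ n

  -- The first child of an odd-height
  -- vertex is marked iff that vertex's parent is not (an odd root has no parent), so every
  -- odd-height vertex sees K exactly once among its neighbours.
  marked : List (Fin m) → Bool
  marked []             = false
  marked (zero ∷ [])    = true
  marked (zero ∷ _ ∷ p) = not (marked p)
  marked (suc _ ∷ _)    = false

  evenLabel : List (Fin m) → ℕ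
  evenLabel p = if marked p then K else 0

  oddLabel : ℕ → ℕ
  oddLabel j = n ℕ.+ (k * altGeomSum m j) ℤ.%ℕ n

  label : Layer → List (Fin m) → ℕ
  label (even _) p = evenLabel p
  label (odd j)  _ = oddLabel j

  coloring : Labeling m d
  coloring (p , _) = + label (layer (d ∸ length p)) p

  oddLabel≡ : ∀ j → + oddLabel j ≡ k * altGeomSum m j mod n
  oddLabel≡ j = ≡-mod-trans (n+x≡x _) (x%n≡x (k * altGeomSum m j))

  marked-first-child : ∀ p → marked (zero ∷ p) ≡ not (marked (drop 1 p))
  marked-first-child []      = refl
  marked-first-child (_ ∷ _) = refl

  evenLabel-complement : ∀ b → + (if b then K else 0) + + (if not b then K else 0) ≡ + K
  evenLabel-complement true  = ℤ.+-identityʳ (+ K)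
  evenLabel-complement false = refl

  evenLabel-children : ∀ p → sumℤ (tabulate (λ c → + evenLabel (c ∷ p))) ≡ + evenLabel (zero ∷ p)
  evenLabel-children p = trans (cong (λ x → + evenLabel (zero ∷ p) + x) (sumℤ-tabulate-zero m₀)) (ℤ.+-identityʳ _)

  open-inner : ∀ L p → + label (above (above L)) (drop 1 p) + sumℤ (tabulate (λ c → + label L (c ∷ p))) ≡ k mod n
  open-inner (even j) p = begin
    + evenLabel (drop 1 p) + sumℤ (tabulate (λ c → + evenLabel (c ∷ p)))
      ≡⟨ cong (λ x → + evenLabel (drop 1 p) + x) (evenLabel-children p) ⟩
    + evenLabel (drop 1 p) + + evenLabel (zero ∷ p)
      ≡⟨ cong (λ b → + evenLabel (drop 1 p) + + (if b then K else 0)) (marked-first-child p) ⟩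
    + evenLabel (drop 1 p) + + (if not (marked (drop 1 p)) then K else 0)
      ≡⟨ evenLabel-complement (marked (drop 1 p)) ⟩
    + K
      ≈⟨ x%n≡x k ⟩
    k ∎
  open-inner (odd j) p = begin
    + oddLabel (suc j) + sumℤ (tabulate {n = m} (λ _ → + oddLabel j))
      ≈⟨ +-cong (oddLabel≡ (suc j)) (sumℤ-tabulate-≡ {m = m} (λ _ → + oddLabel j) (λ _ → oddLabel≡ j)) ⟩
    k * (1ℤ - + m * altGeomSum m j) + + m * (k * altGeomSum m j)
      ≡⟨ cancel k (+ m) (altGeomSum m j) ⟩
    k ∎
    where
    cancel : ∀ k m s → k * (1ℤ - m * s) + m * (k * s) ≡ k
    cancel = solve-∀

  -- The parent's label; at the root, the label a parent would get.
  parentLabel : Vertex m d → ℤ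
  parentLabel v = + label (layer (suc (height v))) (drop 1 (path v))

  parentSum≡parentLabel : RootCondition n k m (layer d) → ∀ v → parentSum coloring v ≡ parentLabel v mod n
  parentSum≡parentLabel rc ([] , _)      = root-parent (layer d) rc
    where
    root-parent : ∀ L → RootCondition n k m L → + 0 ≡ + label (above L) [] mod n
    root-parent (even δ) n∣k*s = ≡-mod-sym (≡-mod-trans (oddLabel≡ δ) (∣⇒≡0 n∣k*s))
    root-parent (odd _)  _     = ≡⇒≡-mod refl
  parentSum≡parentLabel rc (c ∷ p , lt) =
    ≡⇒≡-mod (cong (λ h → + label (layer h) p) (height-child (p , ℕ.<⇒≤ lt) lt c))

  parentLabel+childSum≡k : ∀ v → parentLabel v + childSum coloring v ≡ k mod n
  parentLabel+childSum≡k (p , le) with height (p , le) in height≡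
  ... | zero  = begin
    + oddLabel 0 + childSum coloring (p , le) ≡⟨ cong (λ x → + oddLabel 0 + x) (childSum-leaf coloring (p , le) height≡) ⟩
    + oddLabel 0 + + 0                       ≡⟨ ℤ.+-identityʳ _ ⟩
    + oddLabel 0                             ≈⟨ oddLabel≡ 0 ⟩
    k * 1ℤ                                   ≡⟨ ℤ.*-identityʳ k ⟩
    k                                        ∎
  ... | suc h = begin
    P + childSum coloring (p , le)
      ≡⟨ cong (λ x → P + x) (childSum-inner coloring (p , le) lt) ⟩
    P + sumℤ (tabulate (λ c → + label (layer (d ∸ suc (length p))) (c ∷ p)))
      ≡⟨ cong (λ h′ → P + sumℤ (tabulate (λ c → + label (layer h′) (c ∷ p)))) children-height ⟩
    P + sumℤ (tabulate (λ c → + label (layer h) (c ∷ p)))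
      ≈⟨ open-inner (layer h) p ⟩
    k ∎
    where
    P : ℤ
    P = + label (layer (suc (suc h))) (drop 1 p)
    lt : suc (length p) ≤ d
    lt = height≡suc⇒has-children (p , le) height≡
    children-height : d ∸ suc (length p) ≡ h
    children-height = ℕ.suc-injective (trans (sym (height-child (p , le) lt zero)) height≡)

  coloring-open : RootCondition n k m (layer d) → ∀ v → nbrSum coloring v ≡ k mod n
  coloring-open rc v = ≡-mod-trans (+-cong (parentSum≡parentLabel rc v) (≡⇒≡-mod {x = childSum coloring v} refl))
                                   (parentLabel+childSum≡k v)

  evenLabel<n : ∀ p → evenLabel p < n
  evenLabel<n p with marked p
  ... | true  = n%ℕd<d k n
  ... | false = ℕ.>-nonZero⁻¹ n

  evenLabel<oddLabel : ∀ p j → evenLabel p < oddLabel j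
  evenLabel<oddLabel p j = ℕ.<-≤-trans (evenLabel<n p) (ℕ.m≤m+n n _)

  label-above≢ : ∀ L p q → label (above L) p ≢ label L q
  label-above≢ (even j) p q = ℕ.<⇒≢ (evenLabel<oddLabel q j) ∘ sym
  label-above≢ (odd j)  p q = ℕ.<⇒≢ (evenLabel<oddLabel p j)

  parent≢child : ∀ u v → Child u v → coloring u ≢ coloring v
  parent≢child (p , le) (.(c ∷ p) , lt) (c , refl) eq = label-above≢ (layer (d ∸ suc (length p))) p (c ∷ p)
    (trans (cong (λ h → label (layer h) p) (sym (height-child (p , le) lt c))) (ℤ.+-injective eq))

  coloring-proper : Proper coloring
  coloring-proper u v (inj₁ u→v) = parent≢child u v u→v
  coloring-proper u v (inj₂ v→u) = parent≢child v u v→u ∘ sym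

  palette : List ℤ
  palette = + 0 ∷ + K ∷ map (λ j → + oddLabel j) (upTo ⌈ d /2⌉)

  coloring∈palette : ∀ v → coloring v ∈ palette
  coloring∈palette (p , le) with layer (d ∸ length p) in p-layer
  ... | even _ with marked p
  ...   | true  = there (here refl)
  ...   | false = here refl
  coloring∈palette (p , le) | odd j =
    there (there (∈-map⁺ (λ j → + oddLabel j) (∈-upTo⁺ (1+[j+j]≤n⇒j<⌈n/2⌉ j height≤d))))
    where
    height≤d : suc (j ℕ.+ j) ≤ d
    height≤d = subst (_≤ d) (trans (sym (layerHeight-layer _)) (cong layerHeight p-layer)) (ℕ.m∸n≤m d (length p))

  length-palette : length palette ≡ 2 ℕ.+ ⌈ d /2⌉
  length-palette = cong (2 ℕ.+_) (trans (length-map _ (upTo ⌈ d /2⌉)) (length-upTo ⌈ d /2⌉))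

rootCondition⇒chiLE : ∀ {n k m₀ d} .{{_ : NonZero n}} → RootCondition n k (suc m₀) (layer d) →
                       ChiLE n k (suc m₀) d (2 ℕ.+ ⌈ d /2⌉)
rootCondition⇒chiLE {n} {k} {m₀} {d} rc =
  let r , hasOrder , r≤ = order≤length coloring palette coloring∈palette
  in coloring , coloring-proper , ≡-mod⇒∣x-y ∘ coloring-open rc , r , hasOrder , subst (r ≤_) length-palette r≤
  where open Construction n k m₀ d

open import Data.Nat using (_+_; _/_; _%_)

chiLE-mono : ∀ {n k m d a b} → ChiLE n k m d a → a ≤ b → ChiLE n k m d b
chiLE-mono (ℓ , ℓ-proper , ℓ-open , r , order , r≤a) a≤b =
  ℓ , ℓ-proper , ℓ-open , r , order , ℕ.≤-trans r≤a a≤b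

chiLE⇒chiExists : ∀ {n k m d b} → ChiLE n k m d b → ChiExists n k m d
chiLE⇒chiExists (ℓ , ℓ-proper , ℓ-open , _) = ℓ , ℓ-proper , ℓ-open

2+⌈n/2⌉≤n+1 : ∀ {n} → 2 ≤ n → 2 + ⌈ n /2⌉ ≤ n + 1
2+⌈n/2⌉≤n+1 {suc zero}    (s≤s ())
2+⌈n/2⌉≤n+1 {suc (suc n)} _ = subst (2 + ⌈ suc (suc n) /2⌉ ≤_) (ℕ.+-comm 1 (suc (suc n))) (s≤s (ℕ.⌈n/2⌉<n n))

2+⌈n/2⌉≤n+e+2 : ∀ n e → 2 + ⌈ n /2⌉ ≤ n + e + 2
2+⌈n/2⌉≤n+e+2 n e =
  subst (2 + ⌈ n /2⌉ ≤_) (ℕ.+-comm 2 (n + e)) (ℕ.+-monoʳ-≤ 2 (ℕ.≤-trans (ℕ.⌈n/2⌉≤n n) (ℕ.m≤m+n n e)))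

n≡n%2+[n/2+n/2] : ∀ n → n ≡ n % 2 + (n / 2 + n / 2)
n≡n%2+[n/2+n/2] n = trans (ℕ.m≡m%n+[m/n]*n n 2) (cong (λ q → n % 2 + q) (x*2≡x+x (n / 2)))
  where
  x*2≡x+x : ∀ x → x ℕ.* 2 ≡ x + x
  x*2≡x+x = ℕ-Solver.solve-∀

layer-even : ∀ n → n % 2 ≡ 0 → layer n ≡ even (n / 2)
layer-even n n%2≡0 = begin
  layer n                         ≡⟨ cong layer (n≡n%2+[n/2+n/2] n) ⟩
  layer (n % 2 + (n / 2 + n / 2)) ≡⟨ cong (λ r → layer (r + (n / 2 + n / 2))) n%2≡0 ⟩
  layer (n / 2 + n / 2)           ≡⟨ layer-double (n / 2) ⟩
  even (n / 2)                    ∎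
  where open ≡-Reasoning

layer-odd : ∀ n → n % 2 ≡ 1 → layer n ≡ odd (n / 2)
layer-odd n n%2≡1 = begin
  layer n                         ≡⟨ cong layer (n≡n%2+[n/2+n/2] n) ⟩
  layer (n % 2 + (n / 2 + n / 2)) ≡⟨ cong (λ r → layer (r + (n / 2 + n / 2))) n%2≡1 ⟩
  above (layer (n / 2 + n / 2))   ≡⟨ cong above (layer-double (n / 2)) ⟩
  odd (n / 2)                     ∎
  where open ≡-Reasoning

theorem6p12 : (k : ℤ) (n m d : ℕ) → 2 ≤ n → 1 ≤ m → 1 ≤ d → ¬ ((+ n) ∣ k) →
    (d % 2 ≡ 0 →
      (ChiExists n k m d ⇔ (+ n) ∣ cond k m (d / 2))
      × ((+ n) ∣ cond k m (d / 2) → ChiLE n k m d (d + 1)))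
    × (d % 2 ≡ 1 →
      ChiExists n k m d
      × ((+ n) ∣ cond k m (d / 2) → ChiLE n k m d (d + 1))
      × (¬ ((+ n) ∣ cond k m (d / 2)) → ChiLE n k m d (d + d / 2 + 2)))
theorem6p12 k (suc zero) m d (s≤s ()) _ _ _
theorem6p12 k n@(suc (suc _)) m@(suc _) d _ _ 1≤d n∤k = even-case , odd-case
  where
  δ : ℕ
  δ = d / 2
  open Equivalence (∣cond⇔∣k*altGeomSum n k m δ) using (to; from)

  construct : ∀ {L} → layer d ≡ L → RootCondition n k m L → ChiLE n k m d (2 + ⌈ d /2⌉)
  construct d-layer = rootCondition⇒chiLE ∘ subst (RootCondition n k m) (sym d-layer)

  even-case : d % 2 ≡ 0 →
    (ChiExists n k m d ⇔ + n ∣ cond k m δ) × (+ n ∣ cond k m δ → ChiLE n k m d (d + 1))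
  even-case d-even = mk⇔ necessary (chiLE⇒chiExists ∘ sufficient) , sufficient
    where
    necessary : ChiExists n k m d → + n ∣ cond k m δ
    necessary = from ∘ subst (RootCondition n k m) (layer-even d d-even) ∘ chiExists⇒rootCondition
    d≢1 : 1 ≢ d
    d≢1 1≡d = ℕ.1+n≢0 (trans (cong (_% 2) 1≡d) d-even)
    sufficient : + n ∣ cond k m δ → ChiLE n k m d (d + 1)
    sufficient n∣cond =
      chiLE-mono (construct (layer-even d d-even) (to n∣cond)) (2+⌈n/2⌉≤n+1 (ℕ.≤∧≢⇒< 1≤d d≢1))

  odd-case : d % 2 ≡ 1 → ChiExists n k m d × (+ n ∣ cond k m δ → ChiLE n k m d (d + 1))
                                           × (¬ (+ n ∣ cond k m δ) → ChiLE n k m d (d + δ + 2))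
  odd-case d-odd = chiLE⇒chiExists χ
                 , chiLE-mono χ ∘ 2+⌈n/2⌉≤n+1 ∘ ℕ.≤∧≢⇒< 1≤d ∘ d≢1
                 , λ _ → chiLE-mono χ (2+⌈n/2⌉≤n+e+2 d δ)
    where
    χ : ChiLE n k m d (2 + ⌈ d /2⌉)
    χ = construct (layer-odd d d-odd) tt
    d≢1 : + n ∣ cond k m δ → 1 ≢ d
    d≢1 n∣cond 1≡d = n∤k (∣cond[0]⇒∣k n k m (subst (λ d → + n ∣ cond k m (d / 2)) (sym 1≡d) n∣cond))
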